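{- Let $M$ be a finite matroid. Let $e_1,\dots,e_k$ be distinct elements of $M$ and $C_0,C_1,\dots,C_k$ subsets of $M$ such that $|C_i|\ge 3$ for $i=0,\dots,k$, $C_{i-1}\cap C_i=\{e_i\}$ for $i=1,\dots,k$, and $C_i\cap C_j=\emptyset$ whenever $|i-j|\ge 2$. Let $e_0\in C_0\setminus\{e_1\}$ and $e_i'\in C_{i-1}\setminus\{e_{i-1},e_i\}$ for $i=1,\dots,k$. Set $M_0:=M$ and $M_i:=M_{i-1}/(C_{i-1}\setminus\{e_i,e_i'\})$ for $i=1,\dots,k$. If $C_i$ is a circuit of $M_i$ for every $i=0,1,\dots,k$, then $M$ contains a circuit of length at least $k+3$ containing $e_0$.
   Context: $M/X$ denotes contraction of the set $X$; the length of a circuit is its number of elements. -}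

module Defs where

open import Data.Nat using (ℕ; zero; suc)
open import Data.Fin using (Fin)
open import Data.Fin.Subset using (Subset; _∈_; _⊆_; _∪_; _─_; _-_; ⁅_⁆; ⊥; Nonempty)
open import Data.Product using (Σ; ∃; _×_)
open import Relation.Binary.PropositionalEquality using (_≡_; _≢_)
open import Relation.Nullary using (¬_)

CircFam : ℕ → Set₁
CircFam n = Subset n → Set

record Matroid (n : ℕ) : Set₁ where
  field
    Circuit : CircFam n
    C1 : ¬ Circuit ⊥
    C2 : ∀ {C D} → Circuit C → Circuit D → C ⊆ D → C ≡ D
    C3 : ∀ {C D e} → Circuit C → Circuit D → C ≢ D → e ∈ C → e ∈ D →
         ∃ λ C′ → Circuit C′ × C′ ⊆ ((C ∪ D) - e)

open Matroid public

-- Contraction at the level of circuits (Oxley, Prop. 3.1.11):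
-- the circuits of M/X are the minimal non-empty members of
-- { C ─ X : C a circuit of M }.  (Ground set of M/X is E ─ X; all
-- these sets avoid X automatically.)
contract : ∀ {n} → CircFam n → Subset n → CircFam n
contract 𝒞 X D =
  (∃ λ C → 𝒞 C × D ≡ C ─ X) ×
  Nonempty D ×
  (∀ C → 𝒞 C → Nonempty (C ─ X) → (C ─ X) ⊆ D → (C ─ X) ≡ D)

contractSeq : ∀ {n} → CircFam n → (C : ℕ → Subset n) → (e e′ : ℕ → Fin n) → ℕ → CircFam n
contractSeq 𝒞 C e e′ zero = 𝒞
contractSeq 𝒞 C e e′ (suc i) =
  contract (contractSeq 𝒞 C e e′ i) (C i ─ (⁅ e (suc i) ⁆ ∪ ⁅ e′ (suc i) ⁆))

-- Descend from i = k to i = 0, keeping a circuit G of M through e_i such that the part of G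
-- surviving in M_i lies in C_i ∪ ⋯ ∪ C_k and contains exactly one circuit D of M_i; this D
-- passes through e_i and has at least k + 3 − i elements. At i = k a lift of C_k will do.
-- For the step from i + 1 to i, first make G pass through e_i by strong circuit elimination
-- of e_{i+1} against a lift of C_i. Since C_i becomes the two-element circuit {e_{i+1}, e′_{i+1}}
-- of M_{i+1} = M_i / X_i, every circuit of M_i in the surviving part of the new G contains
-- D − e_{i+1} and one of e_{i+1}, e′_{i+1}; the one through e_i ∈ X_i is therefore larger than D.
-- At i = 0 nothing has been contracted, so D = G. Circuits of a contraction are defined by an
-- undecidable minimality condition, so the bound is obtained under double negation and then
-- recovered because ≤ is decidable.

module Submission where

open import Defs
open import Data.Nat using (ℕ; zero; suc; _+_; _≤_; _<_; s≤s; z≤n; _≤?_)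
open import Data.Nat.Properties
  using (module ≤-Reasoning; ≤-refl; ≤-reflexive; ≤-trans; <⇒≤; n≤1+n; m≤n+m; m≤m+n; m≤n⇒m<n∨m≡n;
         +-comm; +-suc; +-identityʳ; +-monoˡ-≤; 1+n≢n)
open import Data.Nat.Induction using (<-wellFounded)
open import Induction.WellFounded using (Acc; acc)
open import Data.Bool.Properties using () renaming (_≟_ to _≟ᵇ_)
open import Data.Fin using (Fin; zero; suc)
open import Data.Fin.Properties using (any?)
open import Data.Fin.Subset
  using (Subset; inside; outside; _∈_; _∉_; _⊆_; _⊂_; _∩_; _∪_; _─_; _-_; ⁅_⁆; ⊥; ∣_∣; Nonempty)
open import Data.Fin.Subset.Properties
  using (_∈?_; p─q⊆p; x∈p∧x∉q⇒x∈p─q; p─⊥≡p; x∈p∪q⁺; x∈p∪q⁻; p⊆p∪q; q⊆p∪q; p⊂q⇒∣p∣<∣q∣;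
         x∈⁅x⁆; x∈⁅y⁆⇒x≡y; x∈p∩q⁺; x∈p∩q⁻; ∉⊥; ⊆-antisym; ⊆-refl; ⊆-trans; p⊆q⇒∣p∣≤∣q∣; nonempty?)
open import Data.Vec.Base using (_∷_; here; there)
open import Data.Vec.Properties using (≡-dec)
open import Data.Product using (∃; _×_; _,_; proj₁; proj₂)
open import Data.Sum using (_⊎_; inj₁; inj₂; [_,_]′)
import Data.Sum as Sum
open import Data.Empty using (⊥-elim)
open import Level using (0ℓ)
open import Effect.Monad using (RawMonad)
open import Function using (id; _∘_; case_of_)
import Function.Identity.Effectful as Identity
open import Relation.Nullary using (¬_; Dec; yes; no)
open import Relation.Nullary.Decidable using (_×-dec_; ¬?; decidable-stable; ¬¬-excluded-middle)
open import Relation.Nullary.Negation using (¬¬-Monad)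
open import Relation.Binary.PropositionalEquality using (_≡_; _≢_; refl; sym; trans; subst; cong)

private variable
  n : ℕ
  p q r : Subset n
  x y : Fin n

x∈p─q⇒x∉q : ∀ (p q : Subset n) → x ∈ p ─ q → x ∉ q
x∈p─q⇒x∉q (inside ∷ p) (outside ∷ q) here ()
x∈p─q⇒x∉q (_ ∷ p) (_ ∷ q) (there x∈p─q) (there x∈q) = x∈p─q⇒x∉q p q x∈p─q x∈q

∣p∣≤1+∣p-x∣ : ∀ (p : Subset n) x → ∣ p ∣ ≤ suc ∣ p - x ∣
∣p∣≤1+∣p-x∣ (inside  ∷ p) zero = ≤-reflexive (cong (suc ∘ ∣_∣) (sym (p─⊥≡p p)))
∣p∣≤1+∣p-x∣ (outside ∷ p) zero = ≤-trans (≤-reflexive (cong ∣_∣ (sym (p─⊥≡p p)))) (n≤1+n _)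
∣p∣≤1+∣p-x∣ (inside  ∷ p) (suc x) = s≤s (∣p∣≤1+∣p-x∣ p x)
∣p∣≤1+∣p-x∣ (outside ∷ p) (suc x) = ∣p∣≤1+∣p-x∣ p x

p⊆q⇒p─r⊆q─r : ∀ {p q} (r : Subset n) → p ⊆ q → p ─ r ⊆ q ─ r
p⊆q⇒p─r⊆q─r {p = p} r p⊆q x∈p─r = x∈p∧x∉q⇒x∈p─q (p⊆q (p─q⊆p p r x∈p─r)) (x∈p─q⇒x∉q p r x∈p─r)

∣p∪q∣<∣r∣ : p ⊆ r → q ⊆ r → x ∈ r → x ∉ p → x ∉ q → ∣ p ∪ q ∣ < ∣ r ∣
∣p∪q∣<∣r∣ {p = p} {q = q} {x = x} p⊆r q⊆r x∈r x∉p x∉q =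
  p⊂q⇒∣p∣<∣q∣ (p∪q⊆r , x , x∈r , [ x∉p , x∉q ]′ ∘ x∈p∪q⁻ p q)
  where
  p∪q⊆r : p ∪ q ⊆ _
  p∪q⊆r y∈p∪q = [ p⊆r , q⊆r ]′ (x∈p∪q⁻ p q y∈p∪q)

2+∣p∣≤∣q∣ : p ⊆ q → x ∈ q → y ∈ q → x ∉ p → y ∉ p → x ≢ y → 2 + ∣ p ∣ ≤ ∣ q ∣
2+∣p∣≤∣q∣ {p = p} {q = q} {x = x} {y = y} p⊆q x∈q y∈q x∉p y∉p x≢y = begin-strict
  suc ∣ p ∣               ≤⟨ p⊂q⇒∣p∣<∣q∣ (p⊆p∪q _ , x , x∈p∪x , x∉p) ⟩
  ∣ p ∪ ⁅ x ⁆ ∣           <⟨ p⊂q⇒∣p∣<∣q∣ (p⊆p∪q _ , y , x∈p∪q⁺ (inj₂ (x∈⁅x⁆ y)) , y∉p∪x) ⟩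
  ∣ (p ∪ ⁅ x ⁆) ∪ ⁅ y ⁆ ∣ ≤⟨ p⊆q⇒∣p∣≤∣q∣ p∪x∪y⊆q ⟩
  ∣ q ∣                   ∎
  where
  open ≤-Reasoning
  x∈p∪x : x ∈ p ∪ ⁅ x ⁆
  x∈p∪x = x∈p∪q⁺ (inj₂ (x∈⁅x⁆ x))
  y∉p∪x : y ∉ p ∪ ⁅ x ⁆
  y∉p∪x y∈ = [ y∉p , (λ y∈x → x≢y (sym (x∈⁅y⁆⇒x≡y x y∈x))) ]′ (x∈p∪q⁻ p ⁅ x ⁆ y∈)
  p∪x∪y⊆q : (p ∪ ⁅ x ⁆) ∪ ⁅ y ⁆ ⊆ q
  p∪x∪y⊆q z∈ with x∈p∪q⁻ (p ∪ ⁅ x ⁆) ⁅ y ⁆ z∈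
  ... | inj₂ z∈y = subst (_∈ q) (sym (x∈⁅y⁆⇒x≡y y z∈y)) y∈q
  ... | inj₁ z∈p∪x with x∈p∪q⁻ p ⁅ x ⁆ z∈p∪x
  ...   | inj₁ z∈p = p⊆q z∈p
  ...   | inj₂ z∈x = subst (_∈ q) (sym (x∈⁅y⁆⇒x≡y x z∈x)) x∈q

⊆-or-∃∉ : ∀ (p q : Subset n) → p ⊆ q ⊎ ∃ λ x → x ∈ p × x ∉ q
⊆-or-∃∉ p q with any? (λ x → x ∈? p ×-dec ¬? (x ∈? q))
... | yes witness = inj₂ witness
... | no ∄ = inj₁ λ {x} x∈p → decidable-stable (x ∈? q) λ x∉q → ∄ (x , x∈p , x∉q)

⊆∧≢⇒⊂ : p ⊆ q → p ≢ q → p ⊂ q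
⊆∧≢⇒⊂ {p = p} {q = q} p⊆q p≢q with ⊆-or-∃∉ q p
... | inj₁ q⊆p = ⊥-elim (p≢q (⊆-antisym p⊆q q⊆p))
... | inj₂ (x , x∈q , x∉p) = p⊆q , x , x∈q , x∉p

infix 4 _≟ˢ_

_≟ˢ_ : (p q : Subset n) → Dec (p ≡ q)
_≟ˢ_ = ≡-dec _≟ᵇ_

infix 4 _⊆_∪_∖_

_⊆_∪_∖_ : Subset n → Subset n → Subset n → Fin n → Set
G ⊆ C ∪ D ∖ e = ∀ {y} → y ∈ G → (y ∈ C ⊎ y ∈ D) × y ≢ e

⊆∪∖⇒⊆∪ : ∀ {G C D : Subset n} {e} → G ⊆ C ∪ D ∖ e → G ⊆ C ∪ D
⊆∪∖⇒⊆∪ G⊆ y∈G = x∈p∪q⁺ (proj₁ (G⊆ y∈G))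

⊆∪∖⇒∉ : ∀ {G C D : Subset n} {e} → G ⊆ C ∪ D ∖ e → e ∉ G
⊆∪∖⇒∉ G⊆ e∈G = proj₂ (G⊆ e∈G) refl

─-⊆∪∖ : ∀ {G C D E X : Subset n} {e} → G ⊆ C ∪ D ∖ e → E ⊆ G ─ X → E ⊆ C ─ X ∪ D ─ X ∖ e
─-⊆∪∖ {G = G} {X = X} G⊆ E⊆G─X y∈E with y∉X ← x∈p─q⇒x∉q G X (E⊆G─X y∈E) | G⊆ (p─q⊆p G X (E⊆G─X y∈E))
... | y∈C⊎y∈D , y≢e = Sum.map (λ y∈C → x∈p∧x∉q⇒x∈p─q y∈C y∉X) (λ y∈D → x∈p∧x∉q⇒x∈p─q y∈D y∉X) y∈C⊎y∈D
                    , y≢e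

module StrongElimination {T : Set → Set} (monad : RawMonad T) (𝒞 : CircFam n)
  (incomparable : ∀ {C D} → 𝒞 C → 𝒞 D → C ⊆ D → C ≡ D)
  (eliminate : ∀ {C D e} → 𝒞 C → 𝒞 D → C ≢ D → e ∈ C → e ∈ D →
               T (∃ λ G → 𝒞 G × G ⊆ C ∪ D ∖ e))
  where
  open RawMonad monad

  strong-eliminate : ∀ {C₁ C₂ e f} → 𝒞 C₁ → 𝒞 C₂ → e ∈ C₁ → e ∈ C₂ → f ∈ C₁ → f ∉ C₂ →
                     T (∃ λ G → 𝒞 G × f ∈ G × G ⊆ C₁ ∪ C₂ ∖ e)
  strong-eliminate {C₁} {C₂} = go (<-wellFounded ∣ C₁ ∪ C₂ ∣)
    where
    go : ∀ {C₁ C₂ e f} → Acc _<_ ∣ C₁ ∪ C₂ ∣ → 𝒞 C₁ → 𝒞 C₂ → e ∈ C₁ → e ∈ C₂ → f ∈ C₁ → f ∉ C₂ →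
         T (∃ λ G → 𝒞 G × f ∈ G × G ⊆ C₁ ∪ C₂ ∖ e)
    go {C₁} {C₂} {e} {f} (acc smaller) C₁∈𝒞 C₂∈𝒞 e∈C₁ e∈C₂ f∈C₁ f∉C₂ =
      eliminate C₁∈𝒞 C₂∈𝒞 C₁≢C₂ e∈C₁ e∈C₂ >>= λ (G , G∈𝒞 , G⊆) → recover G∈𝒞 G⊆ (f ∈? G)
      where
      C₁≢C₂ : C₁ ≢ C₂
      C₁≢C₂ refl = f∉C₂ f∈C₁

      f∈C₁∪C₂ : f ∈ C₁ ∪ C₂
      f∈C₁∪C₂ = x∈p∪q⁺ (inj₁ f∈C₁)

      -- If G misses f, pick g ∈ G ─ C₁, eliminate g from C₂ and G keeping e,
      -- then eliminate e from C₁ and the result keeping f.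
      recover : ∀ {G} → 𝒞 G → G ⊆ C₁ ∪ C₂ ∖ e → Dec (f ∈ G) →
                T (∃ λ K → 𝒞 K × f ∈ K × K ⊆ C₁ ∪ C₂ ∖ e)
      recover G∈𝒞 G⊆ (yes f∈G) = pure (_ , G∈𝒞 , f∈G , λ {y} → G⊆ {y})
      recover {G} G∈𝒞 G⊆ (no f∉G) with ⊆-or-∃∉ G C₁
      ... | inj₁ G⊆C₁ = ⊥-elim (⊆∪∖⇒∉ G⊆ (subst (e ∈_) (sym (incomparable G∈𝒞 C₁∈𝒞 G⊆C₁)) e∈C₁))
      ... | inj₂ (g , g∈G , g∉C₁) =
        go (smaller ∣C₂∪G∣<) C₂∈𝒞 G∈𝒞 g∈C₂ g∈G e∈C₂ (⊆∪∖⇒∉ G⊆) >>= λ (H , H∈𝒞 , e∈H , H⊆) →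
        go (smaller (∣C₁∪H∣< H⊆)) C₁∈𝒞 H∈𝒞 e∈C₁ e∈H f∈C₁ (f∉H H⊆) >>= λ (K , K∈𝒞 , f∈K , K⊆) →
        pure (K , K∈𝒞 , f∈K , λ {y} → K⊆C₁∪C₂∖e H⊆ K⊆ {y})
        where
        G⊆C₁∪C₂ : ∀ {y} → y ∈ G → y ∈ C₁ ⊎ y ∈ C₂
        G⊆C₁∪C₂ y∈G = proj₁ (G⊆ y∈G)

        g∈C₂ : g ∈ C₂
        g∈C₂ = [ ⊥-elim ∘ g∉C₁ , id ]′ (G⊆C₁∪C₂ g∈G)

        ∣C₂∪G∣< : ∣ C₂ ∪ G ∣ < ∣ C₁ ∪ C₂ ∣
        ∣C₂∪G∣< = ∣p∪q∣<∣r∣ (q⊆p∪q C₁ C₂) (⊆∪∖⇒⊆∪ G⊆) f∈C₁∪C₂ f∉C₂ f∉G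

        H⊆C₁∪C₂ : ∀ {H} → H ⊆ C₂ ∪ G ∖ g → H ⊆ C₁ ∪ C₂
        H⊆C₁∪C₂ H⊆ y∈H = [ q⊆p∪q C₁ C₂ , ⊆∪∖⇒⊆∪ G⊆ ]′ (proj₁ (H⊆ y∈H))

        ∣C₁∪H∣< : ∀ {H} → H ⊆ C₂ ∪ G ∖ g → ∣ C₁ ∪ H ∣ < ∣ C₁ ∪ C₂ ∣
        ∣C₁∪H∣< H⊆ = ∣p∪q∣<∣r∣ (p⊆p∪q C₂) (H⊆C₁∪C₂ H⊆) (x∈p∪q⁺ (inj₂ g∈C₂)) g∉C₁ (⊆∪∖⇒∉ H⊆)

        f∉H : ∀ {H} → H ⊆ C₂ ∪ G ∖ g → f ∉ H
        f∉H H⊆ f∈H = [ f∉C₂ , f∉G ]′ (proj₁ (H⊆ f∈H))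

        K⊆C₁∪C₂∖e : ∀ {H K} → H ⊆ C₂ ∪ G ∖ g → K ⊆ C₁ ∪ H ∖ e → K ⊆ C₁ ∪ C₂ ∖ e
        K⊆C₁∪C₂∖e H⊆ K⊆ y∈K with K⊆ y∈K
        ... | inj₁ y∈C₁ , y≢e = inj₁ y∈C₁ , y≢e
        ... | inj₂ y∈H  , y≢e = [ inj₂ , G⊆C₁∪C₂ ]′ (proj₁ (H⊆ y∈H)) , y≢e

-- (C3) holds only up to double negation: the minimality clause of `contract` is undecidable.
record IsCircuitFamily (𝒞 : CircFam n) : Set where
  field
    incomparable : ∀ {C D} → 𝒞 C → 𝒞 D → C ⊆ D → C ≡ D
    ¬¬-eliminate : ∀ {C D e} → 𝒞 C → 𝒞 D → C ≢ D → e ∈ C → e ∈ D →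
                   ¬ ¬ (∃ λ G → 𝒞 G × G ⊆ C ∪ D ∖ e)

  open StrongElimination ¬¬-Monad 𝒞 incomparable ¬¬-eliminate public
    renaming (strong-eliminate to ¬¬-strong-eliminate)

module _ (M : Matroid n) where

  matroid-eliminate : ∀ {C D e} → Circuit M C → Circuit M D → C ≢ D → e ∈ C → e ∈ D →
                      ∃ λ G → Circuit M G × G ⊆ C ∪ D ∖ e
  matroid-eliminate {C} {D} {e} C∈M D∈M C≢D e∈C e∈D with C3 M C∈M D∈M C≢D e∈C e∈D
  ... | G , G∈M , G⊆ = G , G∈M , λ y∈G →
    x∈p∪q⁻ C D (p─q⊆p _ _ (G⊆ y∈G)) , λ { refl → x∈p─q⇒x∉q (C ∪ D) ⁅ e ⁆ (G⊆ y∈G) (x∈⁅x⁆ e) }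

  open StrongElimination Identity.monad (Circuit M) (C2 M) matroid-eliminate public
    renaming (strong-eliminate to matroid-strong-eliminate)

  matroid-isCircuitFamily : IsCircuitFamily (Circuit M)
  matroid-isCircuitFamily = record
    { incomparable = C2 M
    ; ¬¬-eliminate = λ C∈M D∈M C≢D e∈C e∈D ¬G → ¬G (matroid-eliminate C∈M D∈M C≢D e∈C e∈D)
    }

contract-avoids : ∀ {𝒞 : CircFam n} {X D} → contract 𝒞 X D → x ∈ D → x ∉ X
contract-avoids {X = X} ((F , _ , refl) , _) x∈F─X = x∈p─q⇒x∉q F X x∈F─X

module Contraction {𝒞 : CircFam n} (isCF : IsCircuitFamily 𝒞) (X : Subset n) where
  open IsCircuitFamily isCF
  open RawMonad (¬¬-Monad {a = 0ℓ})

  private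
    HasSmaller : Subset n → Fin n → Set
    HasSmaller C x = ∃ λ H → 𝒞 H × x ∈ H × H ─ X ⊂ C ─ X

    -- With x ∉ H, strong elimination at y ∈ H ─ X gives a circuit through x
    -- avoiding y, hence a smaller one.
    minimal : ∀ {C x} → 𝒞 C → x ∈ C ─ X → ¬ HasSmaller C x →
              ∀ H → 𝒞 H → Nonempty (H ─ X) → H ─ X ⊆ C ─ X → H ─ X ≡ C ─ X
    minimal {C} {x} C∈𝒞 x∈C─X ∄ H H∈𝒞 (y , y∈H─X) H─X⊆C─X =
      decidable-stable (H ─ X ≟ˢ C ─ X) λ H─X≢C─X → case x ∈? H of λ where
        (yes x∈H) → ∄ (H , H∈𝒞 , x∈H , ⊆∧≢⇒⊂ H─X⊆C─X H─X≢C─X)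
        (no x∉H) → ¬¬-strong-eliminate C∈𝒞 H∈𝒞 (p─q⊆p C X (H─X⊆C─X y∈H─X)) (p─q⊆p H X y∈H─X)
                     (p─q⊆p C X x∈C─X) x∉H
                     λ (K , K∈𝒞 , x∈K , K⊆) → ∄ (K , K∈𝒞 , x∈K , K─X⊂C─X K⊆)
      where
      K─X⊂C─X : ∀ {K} → K ⊆ C ∪ H ∖ y → K ─ X ⊂ C ─ X
      K─X⊂C─X {K} K⊆ = K─X⊆C─X , y , H─X⊆C─X y∈H─X , ⊆∪∖⇒∉ K⊆ ∘ p─q⊆p K X
        where
        K─X⊆C─X : K ─ X ⊆ C ─ X
        K─X⊆C─X z∈K─X with z∉X ← x∈p─q⇒x∉q K X z∈K─X | proj₁ (K⊆ (p─q⊆p K X z∈K─X))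
        ... | inj₁ z∈C = x∈p∧x∉q⇒x∈p─q z∈C z∉X
        ... | inj₂ z∈H = H─X⊆C─X (x∈p∧x∉q⇒x∈p─q z∈H z∉X)

  contract-circuit-within : ∀ {C x} → 𝒞 C → x ∈ C ─ X →
                            ¬ ¬ (∃ λ D → contract 𝒞 X D × x ∈ D × D ⊆ C ─ X)
  contract-circuit-within {C} = go (<-wellFounded ∣ C ─ X ∣)
    where
    go : ∀ {C x} → Acc _<_ ∣ C ─ X ∣ → 𝒞 C → x ∈ C ─ X →
         ¬ ¬ (∃ λ D → contract 𝒞 X D × x ∈ D × D ⊆ C ─ X)
    go {C} {x} (acc smaller) C∈𝒞 x∈C─X = ¬¬-excluded-middle {A = HasSmaller C x} >>= λ where
      (yes (H , H∈𝒞 , x∈H , H─X⊂C─X@(H─X⊆C─X , _))) →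
        go (smaller (p⊂q⇒∣p∣<∣q∣ H─X⊂C─X)) H∈𝒞 (x∈p∧x∉q⇒x∈p─q x∈H (x∈p─q⇒x∉q C X x∈C─X))
          >>= λ (D , D∈𝒞X , x∈D , D⊆H─X) → pure (D , D∈𝒞X , x∈D , λ {_} → ⊆-trans D⊆H─X H─X⊆C─X)
      (no ∄) →
        pure (C ─ X , ((C , C∈𝒞 , refl) , (x , x∈C─X) , minimal C∈𝒞 x∈C─X ∄) , x∈C─X , λ {_} → ⊆-refl)

  contract-incomparable : ∀ {D D′} → contract 𝒞 X D → contract 𝒞 X D′ → D ⊆ D′ → D ≡ D′
  contract-incomparable ((G , G∈𝒞 , D≡G─X) , D≠∅ , _) (_ , _ , minimal′) D⊆D′ =
    trans D≡G─X (minimal′ G G∈𝒞 (subst Nonempty D≡G─X D≠∅) (subst (_⊆ _) D≡G─X D⊆D′))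

  contract-¬¬-eliminate : ∀ {D₁ D₂ e} → contract 𝒞 X D₁ → contract 𝒞 X D₂ → D₁ ≢ D₂ →
                          e ∈ D₁ → e ∈ D₂ → ¬ ¬ (∃ λ E → contract 𝒞 X E × E ⊆ D₁ ∪ D₂ ∖ e)
  contract-¬¬-eliminate {D₁} {D₂} D₁∈@((F₁ , F₁∈𝒞 , refl) , _) D₂∈@((F₂ , F₂∈𝒞 , refl) , _)
                        D₁≢D₂ e∈D₁ e∈D₂ with ⊆-or-∃∉ D₁ D₂
  ... | inj₁ D₁⊆D₂ = ⊥-elim (D₁≢D₂ (contract-incomparable D₁∈ D₂∈ D₁⊆D₂))
  ... | inj₂ (f , f∈F₁─X , f∉F₂─X) =
    ¬¬-strong-eliminate F₁∈𝒞 F₂∈𝒞 (p─q⊆p F₁ X e∈D₁) (p─q⊆p F₂ X e∈D₂) (p─q⊆p F₁ X f∈F₁─X) f∉F₂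
      >>= λ (G , G∈𝒞 , f∈G , G⊆) → contract-circuit-within G∈𝒞 (x∈p∧x∉q⇒x∈p─q f∈G f∉X)
      >>= λ (E , E∈𝒞X , _ , E⊆G─X) → pure (E , E∈𝒞X , λ {_} → ─-⊆∪∖ G⊆ E⊆G─X)
    where
    f∉X : f ∉ X
    f∉X = x∈p─q⇒x∉q F₁ X f∈F₁─X
    f∉F₂ : f ∉ F₂
    f∉F₂ f∈F₂ = f∉F₂─X (x∈p∧x∉q⇒x∈p─q f∈F₂ f∉X)

contract-isCircuitFamily : ∀ {𝒞 : CircFam n} → IsCircuitFamily 𝒞 → ∀ X →
                           IsCircuitFamily (contract 𝒞 X)
contract-isCircuitFamily isCF X = record
  { incomparable = contract-incomparable
  ; ¬¬-eliminate = contract-¬¬-eliminate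
  }
  where open Contraction isCF X

module ContractToPair {𝒞 : CircFam n} (isCF : IsCircuitFamily 𝒞) {C : Subset n} (C∈𝒞 : 𝒞 C)
                      {a b : Fin n} (a∈C : a ∈ C) (b∈C : b ∈ C) (a≢b : a ≢ b) where
  open IsCircuitFamily isCF
  open RawMonad (¬¬-Monad {a = 0ℓ})

  P : Subset n
  P = ⁅ a ⁆ ∪ ⁅ b ⁆

  X : Subset n
  X = C ─ P

  open Contraction isCF X using (contract-circuit-within)
  module 𝒞/X = IsCircuitFamily (contract-isCircuitFamily isCF X)

  a∈P : a ∈ P
  a∈P = x∈p∪q⁺ (inj₁ (x∈⁅x⁆ a))

  b∈P : b ∈ P
  b∈P = x∈p∪q⁺ (inj₂ (x∈⁅x⁆ b))

  ∈P⇒≡a⊎≡b : y ∈ P → y ≡ a ⊎ y ≡ b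
  ∈P⇒≡a⊎≡b y∈P = Sum.map (x∈⁅y⁆⇒x≡y a) (x∈⁅y⁆⇒x≡y b) (x∈p∪q⁻ ⁅ a ⁆ ⁅ b ⁆ y∈P)

  P⊆C : P ⊆ C
  P⊆C y∈P with ∈P⇒≡a⊎≡b y∈P
  ... | inj₁ refl = a∈C
  ... | inj₂ refl = b∈C

  ∈X⇒≢a : y ∈ X → y ≢ a
  ∈X⇒≢a y∈X refl = x∈p─q⇒x∉q C P y∈X a∈P

  ∈X⇒≢b : y ∈ X → y ≢ b
  ∈X⇒≢b y∈X refl = x∈p─q⇒x∉q C P y∈X b∈P

  ∈C∧∉X⇒∈P : y ∈ C → y ∉ X → y ∈ P
  ∈C∧∉X⇒∈P {y} y∈C y∉X = decidable-stable (y ∈? P) (y∉X ∘ x∈p∧x∉q⇒x∈p─q y∈C)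

  P≡C─X : P ≡ C ─ X
  P≡C─X = ⊆-antisym (λ y∈P → x∈p∧x∉q⇒x∈p─q (P⊆C y∈P) (λ y∈X → x∈p─q⇒x∉q C P y∈X y∈P))
                    (λ {y} y∈C─X → ∈C∧∉X⇒∈P (p─q⊆p C X y∈C─X) (x∈p─q⇒x∉q C X y∈C─X))

  P-circuit : contract 𝒞 X P
  P-circuit = (C , C∈𝒞 , P≡C─X) , (a , a∈P) , minimal
    where
    minimal : ∀ H → 𝒞 H → Nonempty (H ─ X) → H ─ X ⊆ P → H ─ X ≡ P
    minimal H H∈𝒞 _ H─X⊆P = trans (cong (_─ X) (incomparable H∈𝒞 C∈𝒞 H⊆C)) (sym P≡C─X)
      where
      H⊆C : H ⊆ C
      H⊆C {y} y∈H with y ∈? X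
      ... | yes y∈X = p─q⊆p C P y∈X
      ... | no y∉X = P⊆C (H─X⊆P (x∈p∧x∉q⇒x∈p─q y∈H y∉X))

  -- In the chain, T and U are what survives of consecutive circuits of M in 𝒞/X and in 𝒞.
  module Extension {T D U : Subset n} (D∈𝒞/X : contract 𝒞 X D) (D⊆T : D ⊆ T) (a∈D : a ∈ D)
           (D-unique : ∀ {D′} → contract 𝒞 X D′ → D′ ⊆ T → D′ ≡ D) (b∉T : b ∉ T)
           (U⊆T∪X∪b : ∀ {y} → y ∈ U → y ∈ T ⊎ y ∈ X ⊎ y ≡ b) (a∈U⇒b∉U : a ∈ U → b ∉ U) where

    private
      ⊆U∖X⇒∈T⊎≡b : ∀ {D′ E} → D′ ⊆ U → E ⊆ D′ ─ X → y ∈ E → y ∈ T ⊎ y ≡ b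
      ⊆U∖X⇒∈T⊎≡b {D′ = D′} D′⊆U E⊆D′─X y∈E with U⊆T∪X∪b (D′⊆U (p─q⊆p D′ X (E⊆D′─X y∈E)))
      ... | inj₁ y∈T = inj₁ y∈T
      ... | inj₂ (inj₁ y∈X) = ⊥-elim (x∈p─q⇒x∉q D′ X (E⊆D′─X y∈E) y∈X)
      ... | inj₂ (inj₂ y≡b) = inj₂ y≡b

    -- A circuit of 𝒞/X inside D′ ─ X lies in T ∪ {b}; it is D, or eliminating b
    -- between it and P gives D.
    circuit⊆U-covers : ∀ {D′} → 𝒞 D′ → D′ ⊆ U → ¬ ¬ (D - a ⊆ D′ × (a ∈ D′ ⊎ b ∈ D′))
    circuit⊆U-covers {D′} D′∈𝒞 D′⊆U with nonempty? (D′ ─ X)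
    ... | no D′─X≡∅ =
      ⊥-elim (a∈U⇒b∉U (D′⊆U (subst (a ∈_) (sym D′≡C) a∈C)) (D′⊆U (subst (b ∈_) (sym D′≡C) b∈C)))
      where
      D′≡C : D′ ≡ C
      D′≡C = incomparable D′∈𝒞 C∈𝒞 λ {y} y∈D′ → case y ∈? X of λ where
        (yes y∈X) → p─q⊆p C P y∈X
        (no y∉X) → ⊥-elim (D′─X≡∅ (y , x∈p∧x∉q⇒x∈p─q y∈D′ y∉X))
    ... | yes (y , y∈D′─X) = contract-circuit-within D′∈𝒞 y∈D′─X >>= λ (E , E∈𝒞/X , _ , E⊆D′─X) →
      through E∈𝒞/X E⊆D′─X (b ∈? E)
      where
      through : ∀ {E} → contract 𝒞 X E → E ⊆ D′ ─ X → Dec (b ∈ E) →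
                ¬ ¬ (D - a ⊆ D′ × (a ∈ D′ ⊎ b ∈ D′))
      through {E} E∈𝒞/X E⊆D′─X (no b∉E) =
        pure ((λ {_} → D-a⊆D′) , inj₁ (E⊆D′ (subst (a ∈_) (sym E≡D) a∈D)))
        where
        E⊆D′ : E ⊆ D′
        E⊆D′ = p─q⊆p D′ X ∘ E⊆D′─X
        E≡D : E ≡ D
        E≡D = D-unique E∈𝒞/X λ y∈E →
          [ id , (λ { refl → ⊥-elim (b∉E y∈E) }) ]′ (⊆U∖X⇒∈T⊎≡b D′⊆U E⊆D′─X y∈E)
        D-a⊆D′ : D - a ⊆ D′
        D-a⊆D′ = E⊆D′ ∘ subst (_ ∈_) (sym E≡D) ∘ p─q⊆p D ⁅ a ⁆
      through {E} E∈𝒞/X E⊆D′─X (yes b∈E) =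
        𝒞/X.¬¬-eliminate E∈𝒞/X P-circuit E≢P b∈E b∈P >>= λ (E′ , E′∈𝒞/X , E′⊆) →
        pure ((λ {_} → D-a⊆D′ E′∈𝒞/X E′⊆) , inj₂ (E⊆D′ b∈E))
        where
        E⊆D′ : E ⊆ D′
        E⊆D′ = p─q⊆p D′ X ∘ E⊆D′─X
        E≢P : E ≢ P
        E≢P refl = a∈U⇒b∉U (D′⊆U (E⊆D′ a∈P)) (D′⊆U (E⊆D′ b∈P))
        E′⊆T : ∀ {E′} → E′ ⊆ E ∪ P ∖ b → E′ ⊆ T
        E′⊆T E′⊆ y∈E′ with E′⊆ y∈E′
        ... | inj₁ y∈E , y≢b = [ id , ⊥-elim ∘ y≢b ]′ (⊆U∖X⇒∈T⊎≡b D′⊆U E⊆D′─X y∈E)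
        ... | inj₂ y∈P , y≢b = [ (λ { refl → D⊆T a∈D }) , ⊥-elim ∘ y≢b ]′ (∈P⇒≡a⊎≡b y∈P)
        D-a⊆E : ∀ {E′} → E′ ⊆ E ∪ P ∖ b → E′ ≡ D → D - a ⊆ E
        D-a⊆E E′⊆ refl z∈D-a with E′⊆ (p─q⊆p D ⁅ a ⁆ z∈D-a)
        ... | inj₁ z∈E , _ = z∈E
        ... | inj₂ z∈P , z≢b = case ∈P⇒≡a⊎≡b z∈P of λ where
          (inj₁ refl) → ⊥-elim (x∈p─q⇒x∉q D ⁅ a ⁆ z∈D-a (x∈⁅x⁆ a))
          (inj₂ z≡b) → ⊥-elim (z≢b z≡b)
        D-a⊆D′ : ∀ {E′} → contract 𝒞 X E′ → E′ ⊆ E ∪ P ∖ b → D - a ⊆ D′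
        D-a⊆D′ E′∈𝒞/X E′⊆ = E⊆D′ ∘ D-a⊆E E′⊆ (D-unique E′∈𝒞/X (E′⊆T E′⊆))

    circuits⊆U-unique : ∀ {D′ D″} → 𝒞 D′ → 𝒞 D″ → D′ ⊆ U → D″ ⊆ U → ¬ ¬ (D′ ≡ D″)
    circuits⊆U-unique {D′} {D″} D′∈𝒞 D″∈𝒞 D′⊆U D″⊆U D′≢D″ =
      circuit⊆U-covers D′∈𝒞 D′⊆U λ (_ , D′∩ab) → circuit⊆U-covers D″∈𝒞 D″⊆U λ (_ , D″∩ab) →
      contradict D′∩ab D″∩ab
      where
      ⊆D′∪D″⇒⊆U : ∀ {G c} → G ⊆ D′ ∪ D″ ∖ c → G ⊆ U
      ⊆D′∪D″⇒⊆U G⊆ y∈G = [ D′⊆U , D″⊆U ]′ (proj₁ (G⊆ y∈G))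
      contradict : (a ∈ D′ ⊎ b ∈ D′) → ¬ (a ∈ D″ ⊎ b ∈ D″)
      contradict (inj₁ a∈D′) (inj₁ a∈D″) = ¬¬-eliminate D′∈𝒞 D″∈𝒞 D′≢D″ a∈D′ a∈D″ λ (G , G∈𝒞 , G⊆) →
        circuit⊆U-covers G∈𝒞 (⊆D′∪D″⇒⊆U G⊆) λ where
          (_ , inj₁ a∈G) → ⊆∪∖⇒∉ G⊆ a∈G
          (_ , inj₂ b∈G) → a∈U⇒b∉U (D′⊆U a∈D′) (⊆D′∪D″⇒⊆U G⊆ b∈G)
      contradict (inj₂ b∈D′) (inj₂ b∈D″) = ¬¬-eliminate D′∈𝒞 D″∈𝒞 D′≢D″ b∈D′ b∈D″ λ (G , G∈𝒞 , G⊆) →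
        circuit⊆U-covers G∈𝒞 (⊆D′∪D″⇒⊆U G⊆) λ where
          (_ , inj₁ a∈G) → a∈U⇒b∉U (⊆D′∪D″⇒⊆U G⊆ a∈G) (D′⊆U b∈D′)
          (_ , inj₂ b∈G) → ⊆∪∖⇒∉ G⊆ b∈G
      contradict (inj₁ a∈D′) (inj₂ b∈D″) = a∈U⇒b∉U (D′⊆U a∈D′) (D″⊆U b∈D″)
      contradict (inj₂ b∈D′) (inj₁ a∈D″) = a∈U⇒b∉U (D″⊆U a∈D″) (D′⊆U b∈D′)

    circuit⊆U-through-X-grows : ∀ {D′ x} → 𝒞 D′ → D′ ⊆ U → x ∈ D′ → x ∈ X → ¬ ¬ (suc ∣ D ∣ ≤ ∣ D′ ∣)
    circuit⊆U-through-X-grows {D′} {x} D′∈𝒞 D′⊆U x∈D′ x∈X =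
      circuit⊆U-covers D′∈𝒞 D′⊆U >>= λ where
        (D-a⊆D′ , inj₁ a∈D′) → pure (grows D-a⊆D′ a∈D′ a∉D-a (∈X⇒≢a x∈X))
        (D-a⊆D′ , inj₂ b∈D′) → pure (grows D-a⊆D′ b∈D′ (b∉T ∘ D⊆T ∘ p─q⊆p D ⁅ a ⁆) (∈X⇒≢b x∈X))
      where
      a∉D-a : a ∉ D - a
      a∉D-a a∈D-a = x∈p─q⇒x∉q D ⁅ a ⁆ a∈D-a (x∈⁅x⁆ a)
      x∉D-a : x ∉ D - a
      x∉D-a x∈D-a = contract-avoids D∈𝒞/X (p─q⊆p D ⁅ a ⁆ x∈D-a) x∈X
      grows : ∀ {c} → D - a ⊆ D′ → c ∈ D′ → c ∉ D - a → x ≢ c → suc ∣ D ∣ ≤ ∣ D′ ∣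
      grows D-a⊆D′ c∈D′ c∉D-a x≢c =
        ≤-trans (s≤s (∣p∣≤1+∣p-x∣ D a)) (2+∣p∣≤∣q∣ D-a⊆D′ x∈D′ c∈D′ x∉D-a c∉D-a x≢c)

module Chain (M : Matroid n) (k : ℕ) (C : ℕ → Subset n) (e e′ : ℕ → Fin n)
  (∣Cₖ∣≥3 : 3 ≤ ∣ C k ∣)
  (Cⱼ∩Cⱼ₊₁ : ∀ {j} → j < k → C j ∩ C (suc j) ≡ ⁅ e (suc j) ⁆)
  (Cᵢ∩Cⱼ≡∅ : ∀ {i j} → j ≤ k → i + 2 ≤ j → C i ∩ C j ≡ ⊥)
  (e₀∈C₀ : e 0 ∈ C 0)
  (eⱼ≢eⱼ₊₁ : ∀ {j} → j < k → e j ≢ e (suc j))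
  (e′ⱼ₊₁∈Cⱼ : ∀ {j} → j < k → e′ (suc j) ∈ C j)
  (e′ⱼ₊₁≢eⱼ : ∀ {j} → j < k → e′ (suc j) ≢ e j)
  (e′ⱼ₊₁≢eⱼ₊₁ : ∀ {j} → j < k → e′ (suc j) ≢ e (suc j))
  (Cᵢ-circuit : ∀ {i} → i ≤ k → contractSeq (Circuit M) C e e′ i (C i))
  where

  open RawMonad (¬¬-Monad {a = 0ℓ})

  Circuits : ℕ → CircFam n
  Circuits = contractSeq (Circuit M) C e e′

  X : ℕ → Subset n
  X j = C j ─ (⁅ e (suc j) ⁆ ∪ ⁅ e′ (suc j) ⁆)

  Circuits-isCircuitFamily : ∀ j → IsCircuitFamily (Circuits j)
  Circuits-isCircuitFamily zero    = matroid-isCircuitFamily M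
  Circuits-isCircuitFamily (suc j) = contract-isCircuitFamily (Circuits-isCircuitFamily j) (X j)

  strip : Subset n → ℕ → Subset n
  strip G zero    = G
  strip G (suc j) = strip G j ─ X j

  strip⊆ : ∀ {G} j → strip G j ⊆ G
  strip⊆ zero    = id
  strip⊆ {G} (suc j) = strip⊆ j ∘ p─q⊆p (strip G j) (X j)

  strip-transfer : ∀ {G G′} j → y ∈ strip G j → y ∈ G′ → y ∈ strip G′ j
  strip-transfer zero    _ y∈G′ = y∈G′
  strip-transfer {G = G} (suc j) y∈ y∈G′ =
    x∈p∧x∉q⇒x∈p─q (strip-transfer j (p─q⊆p (strip G j) (X j) y∈) y∈G′)
                  (x∈p─q⇒x∉q (strip G j) (X j) y∈)

  strip-split : ∀ {G} j → y ∈ strip G j → y ∈ strip G (suc j) ⊎ y ∈ X j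
  strip-split {y = y} j y∈ with y ∈? X j
  ... | yes y∈X = inj₂ y∈X
  ... | no y∉X = inj₁ (x∈p∧x∉q⇒x∈p─q y∈ y∉X)

  circuit-lifts : ∀ j {D} → Circuits j D → ∃ λ G → Circuit M G × strip G j ≡ D
  circuit-lifts zero    {D} D∈M = D , D∈M , refl
  circuit-lifts (suc j) ((F , F∈ , D≡F─X) , _) with circuit-lifts j F∈
  ... | G , G∈M , refl = G , G∈M , sym D≡F─X

  circuit-in-strip : ∀ j {G x} → Circuit M G → x ∈ strip G j →
                     ¬ ¬ (∃ λ D → Circuits j D × x ∈ D × D ⊆ strip G j)
  circuit-in-strip zero    {G} G∈M x∈G = pure (G , G∈M , x∈G , λ {_} → ⊆-refl)
  circuit-in-strip (suc j) {G} G∈M x∈ =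
    circuit-in-strip j G∈M (p─q⊆p (strip G j) (X j) x∈) >>= λ (D , D∈ , x∈D , D⊆) →
    Contraction.contract-circuit-within (Circuits-isCircuitFamily j) (X j) D∈
      (x∈p∧x∉q⇒x∈p─q x∈D (x∈p─q⇒x∉q (strip G j) (X j) x∈)) >>= λ (D′ , D′∈ , x∈D′ , D′⊆) →
    pure (D′ , D′∈ , x∈D′ , λ {_} → p⊆q⇒p─r⊆q─r (X j) D⊆ ∘ D′⊆)

  eⱼ₊₁∈Cⱼ∩Cⱼ₊₁ : ∀ {j} → j < k → e (suc j) ∈ C j ∩ C (suc j)
  eⱼ₊₁∈Cⱼ∩Cⱼ₊₁ j<k = subst (_ ∈_) (sym (Cⱼ∩Cⱼ₊₁ j<k)) (x∈⁅x⁆ _)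

  eⱼ₊₁∈Cⱼ : ∀ {j} → j < k → e (suc j) ∈ C j
  eⱼ₊₁∈Cⱼ {j} = proj₁ ∘ x∈p∩q⁻ (C j) _ ∘ eⱼ₊₁∈Cⱼ∩Cⱼ₊₁

  eⱼ∈Cⱼ : ∀ {j} → j ≤ k → e j ∈ C j
  eⱼ∈Cⱼ {zero}  _   = e₀∈C₀
  eⱼ∈Cⱼ {suc j} j<k = proj₂ (x∈p∩q⁻ (C j) _ (eⱼ₊₁∈Cⱼ∩Cⱼ₊₁ j<k))

  ∈Cⱼ∩Cₘ⇒≡eⱼ₊₁ : ∀ {j m} → m ≤ k → j < m → y ∈ C j → y ∈ C m → y ≡ e (suc j)
  ∈Cⱼ∩Cₘ⇒≡eⱼ₊₁ {y = y} {j} {m} m≤k j<m y∈Cⱼ y∈Cₘ with m≤n⇒m<n∨m≡n j<m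
  ... | inj₂ refl  = x∈⁅y⁆⇒x≡y _ (subst (y ∈_) (Cⱼ∩Cⱼ₊₁ m≤k) (x∈p∩q⁺ (y∈Cⱼ , y∈Cₘ)))
  ... | inj₁ j+1<m =
    ⊥-elim (∉⊥ (subst (y ∈_) (Cᵢ∩Cⱼ≡∅ m≤k (subst (_≤ m) (+-comm 2 j) j+1<m)) (x∈p∩q⁺ (y∈Cⱼ , y∈Cₘ))))

  Cₘ-avoids-Xₗ : ∀ {l m} → m ≤ k → l < m → y ∈ C m → y ∉ X l
  Cₘ-avoids-Xₗ {l = l} m≤k l<m y∈Cₘ y∈Xₗ =
    x∈p─q⇒x∉q (C l) _ y∈Xₗ (x∈p∪q⁺ (inj₁ (subst (_∈ ⁅ _ ⁆) (sym y≡eₗ₊₁) (x∈⁅x⁆ _))))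
    where y≡eₗ₊₁ = ∈Cⱼ∩Cₘ⇒≡eⱼ₊₁ m≤k l<m (p─q⊆p (C l) _ y∈Xₗ) y∈Cₘ

  ∈Cₘ⇒∈strip : ∀ {G m} → m ≤ k → y ∈ C m → y ∈ G → y ∈ strip G m
  ∈Cₘ⇒∈strip {y = y} {G} {m} m≤k y∈Cₘ y∈G = go m ≤-refl
    where
    go : ∀ l → l ≤ m → y ∈ strip G l
    go zero    _   = y∈G
    go (suc l) l<m = x∈p∧x∉q⇒x∈p─q (go l (<⇒≤ l<m)) (Cₘ-avoids-Xₗ m≤k l<m y∈Cₘ)

  InTail : ℕ → Fin n → Set
  InTail i y = ∃ λ m → i ≤ m × m ≤ k × y ∈ C m

  -- k + 3 ≤ ∣ D ∣ + i is the paper's bound k + 3 − i ≤ ∣ D ∣ without truncated subtraction.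
  record Core (i : ℕ) (G : Subset n) : Set where
    field
      D         : Subset n
      D-circuit : Circuits i D
      D⊆strip   : D ⊆ strip G i
      eᵢ∈D      : e i ∈ D
      size      : k + 3 ≤ ∣ D ∣ + i
      unique    : ∀ {D′} → Circuits i D′ → D′ ⊆ strip G i → D′ ≡ D

  record Stage (i : ℕ) : Set where
    field
      G          : Subset n
      G-circuit  : Circuit M G
      eᵢ∈G       : e i ∈ G
      strip⊆tail : ∀ {y} → y ∈ strip G i → InTail i y
      ¬¬core     : ¬ ¬ Core i G

  stage-k : Stage k
  stage-k with circuit-lifts k (Cᵢ-circuit ≤-refl)
  ... | G , G∈M , strip≡Cₖ = record
    { G          = G
    ; G-circuit  = G∈M
    ; eᵢ∈G       = strip⊆ k (⊆strip (eⱼ∈Cⱼ ≤-refl))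
    ; strip⊆tail = λ y∈ → k , ≤-refl , ≤-refl , subst (_ ∈_) strip≡Cₖ y∈
    ; ¬¬core     = pure record
      { D         = C k
      ; D-circuit = Cᵢ-circuit ≤-refl
      ; D⊆strip   = ⊆strip
      ; eᵢ∈D      = eⱼ∈Cⱼ ≤-refl
      ; size      = subst (_≤ ∣ C k ∣ + k) (+-comm 3 k) (+-monoˡ-≤ k ∣Cₖ∣≥3)
      ; unique    = λ D′∈ D′⊆ → IsCircuitFamily.incomparable (Circuits-isCircuitFamily k)
                                  D′∈ (Cᵢ-circuit ≤-refl) (subst (_ ∈_) strip≡Cₖ ∘ D′⊆)
      }
    }
    where
    ⊆strip : C k ⊆ strip G k
    ⊆strip = subst (_ ∈_) (sym strip≡Cₖ)

  module Step {j} (j<k : j < k) (stage : Stage (suc j)) where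
    open Stage stage

    private
      a b : Fin n
      a = e (suc j)
      b = e′ (suc j)
      j≤k : j ≤ k
      j≤k = <⇒≤ j<k
      a∈Cⱼ : a ∈ C j
      a∈Cⱼ = eⱼ₊₁∈Cⱼ j<k
      b∈Cⱼ : b ∈ C j
      b∈Cⱼ = e′ⱼ₊₁∈Cⱼ j<k
      T : Subset n
      T = strip G (suc j)

    module Pair = ContractToPair (Circuits-isCircuitFamily j) (Cᵢ-circuit j≤k) a∈Cⱼ b∈Cⱼ
                                 (e′ⱼ₊₁≢eⱼ₊₁ j<k ∘ sym)

    b∉T : b ∉ T
    b∉T b∈T with strip⊆tail b∈T
    ... | m , j<m , m≤k , b∈Cₘ = e′ⱼ₊₁≢eⱼ₊₁ j<k (∈Cⱼ∩Cₘ⇒≡eⱼ₊₁ m≤k j<m b∈Cⱼ b∈Cₘ)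

    eⱼ∈Xⱼ : e j ∈ X j
    eⱼ∈Xⱼ = x∈p∧x∉q⇒x∈p─q (eⱼ∈Cⱼ j≤k) λ eⱼ∈P →
      [ eⱼ≢eⱼ₊₁ j<k , e′ⱼ₊₁≢eⱼ j<k ∘ sym ]′ (Pair.∈P⇒≡a⊎≡b eⱼ∈P)

    record Successor : Set where
      field
        G′          : Subset n
        G′-circuit  : Circuit M G′
        eⱼ∈G′       : e j ∈ G′
        strip⊆T∪X∪b : ∀ {y} → y ∈ strip G′ j → y ∈ T ⊎ y ∈ X j ⊎ y ≡ b
        a∈⇒b∉       : a ∈ strip G′ j → b ∉ strip G′ j

    -- If e j ∉ G, eliminate a between G and a circuit of M lifting C j, keeping e j.
    successor : Dec (e j ∈ G) → Successor
    successor (yes eⱼ∈G) = record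
      { G′          = G
      ; G′-circuit  = G-circuit
      ; eⱼ∈G′       = eⱼ∈G
      ; strip⊆T∪X∪b = Sum.map₂ inj₁ ∘ strip-split j
      ; a∈⇒b∉       = λ _ b∈ → [ b∉T , (λ b∈X → Pair.∈X⇒≢b b∈X refl) ]′ (strip-split j b∈)
      }
    successor (no eⱼ∉G) with circuit-lifts j (Cᵢ-circuit j≤k)
    ... | Ĉ , Ĉ∈M , strip≡Cⱼ =
      eliminated (matroid-strong-eliminate M Ĉ∈M G-circuit (∈Ĉ a∈Cⱼ) eᵢ∈G (∈Ĉ (eⱼ∈Cⱼ j≤k)) eⱼ∉G)
      where
      ∈Ĉ : ∀ {y} → y ∈ C j → y ∈ Ĉ
      ∈Ĉ = strip⊆ j ∘ subst (_ ∈_) (sym strip≡Cⱼ)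

      eliminated : (∃ λ G′ → Circuit M G′ × e j ∈ G′ × G′ ⊆ Ĉ ∪ G ∖ a) → Successor
      eliminated (G′ , G′∈M , eⱼ∈G′ , G′⊆) = record
        { G′          = G′
        ; G′-circuit  = G′∈M
        ; eⱼ∈G′       = eⱼ∈G′
        ; strip⊆T∪X∪b = ⊆T∪X∪b
        ; a∈⇒b∉       = λ a∈ _ → ⊆∪∖⇒∉ G′⊆ (strip⊆ j a∈)
        }
        where
        ⊆T∪X∪b : ∀ {y} → y ∈ strip G′ j → y ∈ T ⊎ y ∈ X j ⊎ y ≡ b
        ⊆T∪X∪b {y} y∈ with G′⊆ (strip⊆ j y∈) | y ∈? X j
        ... | inj₂ y∈G , _   | _       = Sum.map₂ inj₁ (strip-split j (strip-transfer j y∈ y∈G))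
        ... | inj₁ _   , _   | yes y∈X = inj₂ (inj₁ y∈X)
        ... | inj₁ y∈Ĉ , y≢a | no y∉X  =
          [ ⊥-elim ∘ y≢a , inj₂ ∘ inj₂ ]′ (Pair.∈P⇒≡a⊎≡b (Pair.∈C∧∉X⇒∈P y∈Cⱼ y∉X))
          where
          y∈Cⱼ : y ∈ C j
          y∈Cⱼ = subst (_ ∈_) strip≡Cⱼ (strip-transfer j y∈ y∈Ĉ)

    open Successor (successor (e j ∈? G))

    next-core : Core (suc j) G → ¬ ¬ Core j G′
    next-core core =
      circuit-in-strip j G′-circuit (∈Cₘ⇒∈strip j≤k (eⱼ∈Cⱼ j≤k) eⱼ∈G′)
        >>= λ (D′ , D′∈ , eⱼ∈D′ , D′⊆) →
      circuit⊆U-through-X-grows D′∈ D′⊆ eⱼ∈D′ eⱼ∈Xⱼ >>= λ ∣D∣<∣D′∣ →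
      pure record
        { D         = D′
        ; D-circuit = D′∈
        ; D⊆strip   = D′⊆
        ; eᵢ∈D      = eⱼ∈D′
        ; size      = begin
            k + 3            ≤⟨ size ⟩
            ∣ D ∣ + suc j    ≡⟨ +-suc ∣ D ∣ j ⟩
            suc ∣ D ∣ + j    ≤⟨ +-monoˡ-≤ j ∣D∣<∣D′∣ ⟩
            ∣ D′ ∣ + j       ∎
        ; unique    = λ D″∈ D″⊆ → decidable-stable (_ ≟ˢ D′) (circuits⊆U-unique D″∈ D′∈ D″⊆ D′⊆)
        }
      where
      open Core core
      open Pair.Extension D-circuit D⊆strip eᵢ∈D unique b∉T strip⊆T∪X∪b a∈⇒b∉
      open ≤-Reasoning

    next : Stage j
    next = record
      { G          = G′
      ; G-circuit  = G′-circuit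
      ; eᵢ∈G       = eⱼ∈G′
      ; strip⊆tail = tail
      ; ¬¬core     = ¬¬core >>= next-core
      }
      where
      tail : ∀ {y} → y ∈ strip G′ j → InTail j y
      tail y∈ with strip⊆T∪X∪b y∈
      ... | inj₁ y∈T with m , j<m , m≤k , y∈Cₘ ← strip⊆tail y∈T = m , <⇒≤ j<m , m≤k , y∈Cₘ
      ... | inj₂ (inj₁ y∈X) = j , ≤-refl , j≤k , p─q⊆p (C j) _ y∈X
      ... | inj₂ (inj₂ refl) = j , ≤-refl , j≤k , b∈Cⱼ

  stage : ∀ d {i} → d + i ≡ k → Stage i
  stage zero    refl = stage-k
  stage (suc d) {i} d+1+i≡k = Step.next i<k (stage d (trans (+-suc d i) d+1+i≡k))
    where
    i<k : i < k
    i<k = subst (suc i ≤_) d+1+i≡k (s≤s (m≤n+m i d))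

  long-circuit : ∃ λ D → Circuit M D × e 0 ∈ D × k + 3 ≤ ∣ D ∣
  long-circuit = G , G-circuit , eᵢ∈G , decidable-stable (k + 3 ≤? ∣ G ∣) (¬¬core >>= pure ∘ bound)
    where
    open Stage (stage k (+-identityʳ k))
    bound : Core 0 G → k + 3 ≤ ∣ G ∣
    bound core = subst (k + 3 ≤_) (trans (+-identityʳ ∣ D ∣) (cong ∣_∣ D≡G)) size
      where
      open Core core
      D≡G : D ≡ G
      D≡G = C2 M D-circuit G-circuit D⊆strip

lemma17 : ∀ {n} (M : Matroid n) (k : ℕ) (C : ℕ → Subset n) (e e′ : ℕ → Fin n) →
  (∀ i j → 1 ≤ i → i ≤ k → 1 ≤ j → j ≤ k → e i ≡ e j → i ≡ j) →
  (∀ i → i ≤ k → 3 ≤ ∣ C i ∣) →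
  (∀ i → 1 ≤ i → i ≤ k → (C (i Data.Nat.∸ 1) ∩ C i) ≡ ⁅ e i ⁆) →
  (∀ i j → i ≤ k → j ≤ k → (i + 2 ≤ j ⊎ j + 2 ≤ i) → (C i ∩ C j) ≡ ⊥) →
  e 0 ∈ C 0 →
  (1 ≤ k → e 0 ≢ e 1) →
  (∀ i → 1 ≤ i → i ≤ k →
    e′ i ∈ C (i Data.Nat.∸ 1) × e′ i ≢ e (i Data.Nat.∸ 1) × e′ i ≢ e i) →
  (∀ i → i ≤ k → contractSeq (Circuit M) C e e′ i (C i)) →
  ∃ λ D → Circuit M D × e 0 ∈ D × k + 3 ≤ ∣ D ∣
lemma17 M k C e e′ e-injective ∣C∣≥3 Cᵢ₋₁∩Cᵢ Cᵢ∩Cⱼ≡∅ e₀∈C₀ e₀≢e₁ e′-avoids Cᵢ-circuit =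
  Chain.long-circuit M k C e e′ (∣C∣≥3 k ≤-refl) (Cᵢ₋₁∩Cᵢ _ (s≤s z≤n))
    (λ {i} j≤k i+2≤j → Cᵢ∩Cⱼ≡∅ i _ (≤-trans (m≤m+n i 2) (≤-trans i+2≤j j≤k)) j≤k (inj₁ i+2≤j))
    e₀∈C₀ eⱼ≢eⱼ₊₁
    (proj₁ ∘ e′-avoids _ (s≤s z≤n)) (proj₁ ∘ proj₂ ∘ e′-avoids _ (s≤s z≤n))
    (proj₂ ∘ proj₂ ∘ e′-avoids _ (s≤s z≤n))
    (Cᵢ-circuit _)
  where
  eⱼ≢eⱼ₊₁ : ∀ {j} → j < k → e j ≢ e (suc j)
  eⱼ≢eⱼ₊₁ {zero}  = e₀≢e₁
  eⱼ≢eⱼ₊₁ {suc j} j+1<k eⱼ₊₁≡eⱼ₊₂ =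
    1+n≢n (sym (e-injective _ _ (s≤s z≤n) (<⇒≤ j+1<k) (s≤s z≤n) j+1<k eⱼ₊₁≡eⱼ₊₂))
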